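{- Let $G=(V,E)$, $c$, $k$ (even), $x$, $G^0$, $x^0$, $\lambda$, $T_1,\dots,T_{k/2}$, $T^*$, $B$ and $F$ be as described in the context, for a parameter $\alpha\ge 0$. Then, for every outcome of the random choices, the multi-set $T^*\uplus B\uplus F$ (viewed as a multi-set of edges of $G$ by identifying $u_0$ and $v_0$ with $u$) is a $k$-edge-connected spanning multi-subgraph of $G$.
   Context: Setting (the algorithm). $G=(V,E)$ is an undirected graph with $n=|V|$, $c:E\to\mathbb{R}_{\ge0}$ a metric cost function, $k$ a positive even integer. For $S\subseteq V$, $\delta(S)$ denotes the set of edges with exactly one endpoint in $S$, and $x(F)=\sum_{e\in F}x_e$. Let $x$ be an optimal solution of the LP $\min\sum_e c(e)x_e$ s.t. $x(\delta(v))=k$ for all $v\in V$, $x(\delta(S))\ge k$ for all $\emptyset\ne S\subsetneq V$, $x\ge 0$. Pick a vertex $u\in V$ and form $G^0$ by splitting $u$ into two vertices $u_0,v_0$: each edge $(u,w)$ of $G$ is replaced by two edges $(u_0,w)$ and $(v_0,w)$, each receiving value $x_{(u,w)}/2$; all other edges keep their values; call the result $x^0$ on edge set $E^0$. Each edge of $E^0$ corresponds to an edge of $E$ (identify $u_0,v_0$ with $u$), with the same cost. Let $\lambda:E^0\to\mathbb{R}_{\ge0}$ be weights such that the $\lambda$-uniform distribution $\mu_\lambda$ on spanning trees of $G^0$ (where $\Pr[T]\propto\prod_{e\in T}\lambda(e)$) satisfies $\Pr_{T\sim\mu_\lambda}[e\in T]\le \frac{2}{k}x^0_e(1+2^{ -n})$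 for all $e\in E^0$. Sample $T_1,\dots,T_{k/2}$ independently from $\mu_\lambda$ and let $T^*=T_1\uplus\dots\uplus T_{k/2}$ (multi-set union). Let $B$ consist of $\alpha\sqrt{k/2-1}$ copies of a minimum-cost spanning tree of $G^0$ (the number of copies being treated as an integer). For a spanning tree $T$ of $G^0$ and $e\in T$, $C_T(e)$ denotes the set of edges of $G^0$ crossing the cut obtained by deleting $e$ from $T$; for edge multi-sets $F',T'$, $F'_{T'}=|F'\cap T'|$ counted with multiplicity; "$(u_0,v_0)\notin C$" means $u_0$ and $v_0$ lie on the same side of the cut $C$. Let $F$ be the multi-set containing one copy of $e$ for each pair $(i,e)$ with $i\in[k/2]$, $e\in T_i$, $C_{T_i}(e)_{T^*}<k-\alpha\sqrt{k/2-1}$ and $(u_0,v_0)\notin C_{T_i}(e)$. -}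

module Defs where

open import Data.Nat using (ℕ; zero; suc; _+_; _*_; _∸_; _≤_; _<ᵇ_)
open import Data.Fin using (Fin; zero; suc; inject₁; fromℕ; _≟_)
open import Data.Bool using (Bool; true; false; if_then_else_; _∧_; _∨_; not; _xor_)
open import Data.Sum using (_⊎_; inj₁; inj₂)
open import Data.Sum.Properties using (≡-dec)
open import Data.Product using (_×_; _,_; proj₁; proj₂; ∃)
open import Relation.Nullary using (¬_)
open import Relation.Nullary.Decidable using (⌊_⌋)
open import Relation.Binary.PropositionalEquality using (_≡_; _≢_)

ΣFin : (m : ℕ) → (Fin m → ℕ) → ℕ
ΣFin zero    f = 0
ΣFin (suc m) f = f zero + ΣFin m (λ i → f (suc i))

countFin : (h : ℕ) → (Fin h → Bool) → ℕ
countFin h b = ΣFin h (λ i → if b i then 1 else 0)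

record Graph (n : ℕ) : Set where
  field
    m        : ℕ
    ends     : Fin m → Fin n × Fin n
    loopless : ∀ e → proj₁ (ends e) ≢ proj₂ (ends e)
    simple   : ∀ e f →
               (ends e ≡ ends f) ⊎ (ends e ≡ (proj₂ (ends f) , proj₁ (ends f))) →
               e ≡ f

cutCountG : ∀ {n} (G : Graph n) → (Fin n → Bool) → (Fin (Graph.m G) → ℕ) → ℕ
cutCountG G S M =
  ΣFin (Graph.m G) (λ e →
    if S (proj₁ (Graph.ends G e)) xor S (proj₂ (Graph.ends G e)) then M e else 0)

KEdgeConnected : ∀ {n} (G : Graph n) → ℕ → (Fin (Graph.m G) → ℕ) → Set
KEdgeConnected {n} G k M =
  (S : Fin n → Bool) → ∃ (λ v → S v ≡ true) → ∃ (λ v → S v ≡ false) →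
  k ≤ cutCountG G S M

-- The split graph G⁰: vertex u is split into u₀ and v₀.
-- Edges of G⁰: E0 = Fin m ⊎ Fin m.  inj₁ e is the copy of e with u (if an
-- endpoint) kept as u₀; inj₂ e is the copy of e with u replaced by v₀; the
-- copy inj₂ e only exists (is valid) when e is incident to u.

module Split {n : ℕ} (G : Graph n) (u : Fin n) where
  open Graph G

  V0 : Set
  V0 = Fin (suc n)

  u₀ v₀ : V0
  u₀ = inject₁ u
  v₀ = fromℕ n

  E0 : Set
  E0 = Fin m ⊎ Fin m

  _≟E0_ : (f g : E0) → Bool
  f ≟E0 g = ⌊ ≡-dec _≟_ _≟_ f g ⌋

  incident : Fin m → Bool
  incident e = ⌊ proj₁ (ends e) ≟ u ⌋ ∨ ⌊ proj₂ (ends e) ≟ u ⌋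

  valid : E0 → Bool
  valid (inj₁ e) = true
  valid (inj₂ e) = incident e

  private
    rep : Fin n → V0
    rep w = if ⌊ w ≟ u ⌋ then v₀ else inject₁ w

  ends0 : E0 → V0 × V0
  ends0 (inj₁ e) = inject₁ (proj₁ (ends e)) , inject₁ (proj₂ (ends e))
  ends0 (inj₂ e) = rep (proj₁ (ends e)) , rep (proj₂ (ends e))

  EdgeSet : Set
  EdgeSet = E0 → Bool

  without : EdgeSet → E0 → EdgeSet
  without T f g = T g ∧ not (f ≟E0 g)

  data Walk (T : EdgeSet) : V0 → V0 → Set where
    here  : ∀ {v} → Walk T v v
    stepₗ : ∀ f {w} → T f ≡ true →
            Walk T (proj₂ (ends0 f)) w → Walk T (proj₁ (ends0 f)) w
    stepᵣ : ∀ f {w} → T f ≡ true →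
            Walk T (proj₁ (ends0 f)) w → Walk T (proj₂ (ends0 f)) w

  IsSpanningTree : EdgeSet → Set
  IsSpanningTree T =
    (∀ f → T f ≡ true → valid f ≡ true) ×
    (∀ v w → Walk T v w) ×
    (∀ f → T f ≡ true →
       ¬ Walk (without T f) (proj₁ (ends0 f)) (proj₂ (ends0 f)))

  -- S is the vertex set of the component of T − f containing the first
  -- endpoint of f; then C_T(f) = δ(S).
  IsComponentSide : EdgeSet → E0 → (V0 → Bool) → Set
  IsComponentSide T f S =
    ∀ v → (S v ≡ true → Walk (without T f) (proj₁ (ends0 f)) v) ×
          (Walk (without T f) (proj₁ (ends0 f)) v → S v ≡ true)

  ΣE0 : (E0 → ℕ) → ℕ
  ΣE0 w = ΣFin m (λ e → w (inj₁ e)) + ΣFin m (λ e → w (inj₂ e))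

  cutCount0 : (V0 → Bool) → (E0 → ℕ) → ℕ
  cutCount0 S M =
    ΣE0 (λ f → if S (proj₁ (ends0 f)) xor S (proj₂ (ends0 f)) then M f else 0)

  Tstar : (h : ℕ) → (Fin h → EdgeSet) → E0 → ℕ
  Tstar h T f = countFin h (λ i → T i f)

  Bmult : ℕ → EdgeSet → E0 → ℕ
  Bmult mB B₀ f = mB * (if B₀ f then 1 else 0)

  -- F: one copy of f for each i with f ∈ T_i,
  -- |C_{T_i}(f) ∩ T*| < k − mB, and u₀, v₀ on the same side of C_{T_i}(f).
  -- side i f is the side S of C_{T_i}(f) = δ(S).
  Fmult : (k h mB : ℕ) → (Fin h → EdgeSet) → (Fin h → E0 → V0 → Bool) → E0 → ℕ
  Fmult k h mB T side f =
    countFin h (λ i →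
      T i f ∧ (cutCount0 (side i f) (Tstar h T) <ᵇ (k ∸ mB))
            ∧ not (side i f u₀ xor side i f v₀))

  total0 : (k h mB : ℕ) → (Fin h → EdgeSet) → EdgeSet →
           (Fin h → E0 → V0 → Bool) → E0 → ℕ
  total0 k h mB T B₀ side f =
    Tstar h T f + Bmult mB B₀ f + Fmult k h mB T side f

  project : (E0 → ℕ) → Fin m → ℕ
  project M e = M (inj₁ e) + M (inj₂ e)

-- Fix a cut S of G and lift it to G⁰ with u₀ and v₀ on the side of u; the
-- projection then crosses S exactly as often as T* ⊎ B ⊎ F crosses the lift.
-- If T* already has at least k − mB crossing edges, the mB copies of the tree
-- B₀, each crossing the cut at least once, supply the rest. Otherwise every T_i crosses
-- the cut at least twice, or exactly once through an edge f; in the latter case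
-- the component of T_i − f containing an endpoint of f is one side of the cut
-- itself, so C_{T_i}(f) is the cut, it has fewer than k − mB edges of T* and
-- does not separate u₀ from v₀, hence f is put into F by index i. Either way
-- tree i contributes at least two crossing edges, and the h = k/2 trees give k.
module Submission where

open import Defs
open import Data.Nat using (ℕ; zero; suc; _+_; _*_; _∸_; _≤_; _<_; _<ᵇ_; s≤s; _≤?_)
open import Data.Nat.Properties
open import Data.Fin using (Fin; zero; suc; inject₁; fromℕ) renaming (_≟_ to _≟ᶠ_)
open import Data.Bool using (Bool; true; false; if_then_else_; _∧_; not; _xor_)
open import Data.Bool.Properties using (xor-same; ∧-identityʳ; ∧-zeroʳ; T-≡)
open import Data.Sum using (_⊎_; inj₁; inj₂)
open import Data.Sum.Properties using (≡-dec)
open import Data.Product using (_×_; _,_; proj₁; proj₂; ∃)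
open import Data.Empty using (⊥-elim)
open import Function.Base using (_∘_)
open import Function.Bundles using (Equivalence)
open import Relation.Nullary using (Dec; yes; no)
open import Relation.Nullary.Decidable using (⌊_⌋)
open import Relation.Binary.PropositionalEquality
open import Algebra.Properties.CommutativeSemigroup +-commutativeSemigroup using (interchange)

ΣFin-cong : ∀ m {p q : Fin m → ℕ} → (∀ i → p i ≡ q i) → ΣFin m p ≡ ΣFin m q
ΣFin-cong zero    eq = refl
ΣFin-cong (suc m) eq = cong₂ _+_ (eq zero) (ΣFin-cong m (λ i → eq (suc i)))

ΣFin-+ : ∀ m (p q : Fin m → ℕ) → ΣFin m (λ i → p i + q i) ≡ ΣFin m p + ΣFin m q
ΣFin-+ zero    p q = refl
ΣFin-+ (suc m) p q =
  trans (cong ((p zero + q zero) +_) (ΣFin-+ m (λ i → p (suc i)) (λ i → q (suc i))))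
        (interchange (p zero) (q zero) _ _)

ΣFin-0 : ∀ m → ΣFin m (λ _ → 0) ≡ 0
ΣFin-0 zero    = refl
ΣFin-0 (suc m) = ΣFin-0 m

ΣFin-comm : ∀ m h (W : Fin h → Fin m → ℕ) →
  ΣFin m (λ e → ΣFin h (λ i → W i e)) ≡ ΣFin h (λ i → ΣFin m (W i))
ΣFin-comm zero    h W = sym (ΣFin-0 h)
ΣFin-comm (suc m) h W =
  trans (cong (ΣFin h (λ i → W i zero) +_) (ΣFin-comm m h (λ i e → W i (suc e))))
        (sym (ΣFin-+ h (λ i → W i zero) (λ i → ΣFin m (λ e → W i (suc e)))))

term≤ΣFin : ∀ m (p : Fin m → ℕ) i → p i ≤ ΣFin m p
term≤ΣFin (suc m) p zero    = m≤m+n _ _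
term≤ΣFin (suc m) p (suc i) = ≤-trans (term≤ΣFin m (λ j → p (suc j)) i) (m≤n+m _ _)

twoTerms≤ΣFin : ∀ m (p : Fin m → ℕ) i j → i ≢ j → p i + p j ≤ ΣFin m p
twoTerms≤ΣFin (suc m) p zero    zero    i≢j = ⊥-elim (i≢j refl)
twoTerms≤ΣFin (suc m) p zero    (suc j) i≢j = +-monoʳ-≤ (p zero) (term≤ΣFin m _ j)
twoTerms≤ΣFin (suc m) p (suc i) zero    i≢j =
  subst (_≤ ΣFin (suc m) p) (+-comm (p zero) (p (suc i)))
    (+-monoʳ-≤ (p zero) (term≤ΣFin m _ i))
twoTerms≤ΣFin (suc m) p (suc i) (suc j) i≢j =
  ≤-trans (twoTerms≤ΣFin m _ i j (i≢j ∘ cong suc)) (m≤n+m _ _)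

*-≤-ΣFin : ∀ m c (p : Fin m → ℕ) → (∀ i → c ≤ p i) → c * m ≤ ΣFin m p
*-≤-ΣFin zero    c p c≤p = ≤-reflexive (*-zeroʳ c)
*-≤-ΣFin (suc m) c p c≤p = begin
  c * suc m       ≡⟨ *-suc c m ⟩
  c + c * m       ≤⟨ +-mono-≤ (c≤p zero) (*-≤-ΣFin m c _ (λ i → c≤p (suc i))) ⟩
  ΣFin (suc m) p  ∎
  where open ≤-Reasoning

mask : Bool → ℕ → ℕ
mask c x = if c then x else 0

mask-true : ∀ {c} x → c ≡ true → mask c x ≡ x
mask-true x refl = refl

mask-+ : ∀ c x y → mask c (x + y) ≡ mask c x + mask c y
mask-+ true  x y = refl
mask-+ false x y = refl

mask-ΣFin : ∀ c h (w : Fin h → ℕ) → mask c (ΣFin h w) ≡ ΣFin h (λ i → mask c (w i))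
mask-ΣFin true  h w = refl
mask-ΣFin false h w = sym (ΣFin-0 h)

xor≡false⇒≡ : ∀ {a b} → a xor b ≡ false → a ≡ b
xor≡false⇒≡ {true}  {true}  _ = refl
xor≡false⇒≡ {false} {false} _ = refl

xor≡true⇒≢ : ∀ {a b} → a xor b ≡ true → a ≢ b
xor≡true⇒≢ {true}  {true}  ()
xor≡true⇒≢ {false} {false} ()

⇔⇒≡-not-xor : ∀ b x c → (b ≡ true → x ≡ c) → (x ≡ c → b ≡ true) →
  b ≡ not (x xor c)
⇔⇒≡-not-xor true  x c ⇒ _ with ⇒ refl
... | refl = sym (cong not (xor-same x))
⇔⇒≡-not-xor false true  true  _ ⇐ with ⇐ refl
... | ()
⇔⇒≡-not-xor false true  false _ _ = refl
⇔⇒≡-not-xor false false true  _ _ = refl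
⇔⇒≡-not-xor false false false _ ⇐ with ⇐ refl
... | ()

not-xor-xor-not-xor : ∀ x y c → not (x xor c) xor not (y xor c) ≡ x xor y
not-xor-xor-not-xor true  true  true  = refl
not-xor-xor-not-xor true  true  false = refl
not-xor-xor-not-xor true  false true  = refl
not-xor-xor-not-xor true  false false = refl
not-xor-xor-not-xor false true  true  = refl
not-xor-xor-not-xor false true  false = refl
not-xor-xor-not-xor false false true  = refl
not-xor-xor-not-xor false false false = refl

extend : ∀ {a} {A : Set a} {n} → (Fin n → A) → A → Fin (suc n) → A
extend {n = zero}  f x zero    = x
extend {n = suc n} f x zero    = f zero
extend {n = suc n} f x (suc i) = extend (λ j → f (suc j)) x i

extend-inject₁ : ∀ {a} {A : Set a} {n} (f : Fin n → A) x i → extend f x (inject₁ i) ≡ f i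
extend-inject₁ {n = suc n} f x zero    = refl
extend-inject₁ {n = suc n} f x (suc i) = extend-inject₁ (λ j → f (suc j)) x i

extend-fromℕ : ∀ {a} {A : Set a} n (f : Fin n → A) x → extend f x (fromℕ n) ≡ x
extend-fromℕ zero    f x = refl
extend-fromℕ (suc n) f x = extend-fromℕ n (λ j → f (suc j)) x

module SplitProperties {n : ℕ} (G : Graph n) (u : Fin n) where
  open Graph G
  open Split G u

  ΣE0-cong : {p q : E0 → ℕ} → (∀ g → p g ≡ q g) → ΣE0 p ≡ ΣE0 q
  ΣE0-cong eq =
    cong₂ _+_ (ΣFin-cong m (λ e → eq (inj₁ e))) (ΣFin-cong m (λ e → eq (inj₂ e)))

  ΣE0-+ : (p q : E0 → ℕ) → ΣE0 (λ g → p g + q g) ≡ ΣE0 p + ΣE0 q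
  ΣE0-+ p q =
    trans (cong₂ _+_ (ΣFin-+ m (λ e → p (inj₁ e)) (λ e → q (inj₁ e)))
                     (ΣFin-+ m (λ e → p (inj₂ e)) (λ e → q (inj₂ e))))
          (interchange (ΣFin m (λ e → p (inj₁ e))) _ _ _)

  ΣE0-comm : ∀ h (W : Fin h → E0 → ℕ) →
    ΣE0 (λ g → ΣFin h (λ i → W i g)) ≡ ΣFin h (λ i → ΣE0 (W i))
  ΣE0-comm h W =
    trans (cong₂ _+_ (ΣFin-comm m h (λ i e → W i (inj₁ e)))
                     (ΣFin-comm m h (λ i e → W i (inj₂ e))))
          (sym (ΣFin-+ h _ _))

  term≤ΣE0 : ∀ (p : E0 → ℕ) g → p g ≤ ΣE0 p
  term≤ΣE0 p (inj₁ e) = ≤-trans (term≤ΣFin m _ e) (m≤m+n _ _)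
  term≤ΣE0 p (inj₂ e) = ≤-trans (term≤ΣFin m _ e) (m≤n+m _ _)

  twoTerms≤ΣE0 : ∀ (p : E0 → ℕ) g g′ → g ≢ g′ → p g + p g′ ≤ ΣE0 p
  twoTerms≤ΣE0 p (inj₁ e) (inj₁ e′) g≢g′ =
    ≤-trans (twoTerms≤ΣFin m _ e e′ (g≢g′ ∘ cong inj₁)) (m≤m+n _ _)
  twoTerms≤ΣE0 p (inj₂ e) (inj₂ e′) g≢g′ =
    ≤-trans (twoTerms≤ΣFin m _ e e′ (g≢g′ ∘ cong inj₂)) (m≤n+m _ _)
  twoTerms≤ΣE0 p (inj₁ e) (inj₂ e′) _ = +-mono-≤ (term≤ΣFin m _ e) (term≤ΣFin m _ e′)
  twoTerms≤ΣE0 p (inj₂ e) (inj₁ e′) _ =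
    subst (_≤ ΣE0 p) (+-comm (p (inj₁ e′)) (p (inj₂ e)))
      (+-mono-≤ (term≤ΣFin m _ e′) (term≤ΣFin m _ e))

  _≟E_ : (f g : E0) → Dec (f ≡ g)
  _≟E_ = ≡-dec _≟ᶠ_ _≟ᶠ_

  without⁺ : ∀ T f {g} → T g ≡ true → f ≢ g → without T f g ≡ true
  without⁺ T f {g} Tg f≢g with f ≟E g
  ... | yes f≡g = ⊥-elim (f≢g f≡g)
  ... | no  _   = trans (∧-identityʳ (T g)) Tg

  without⁻ : ∀ T f {g} → without T f g ≡ true → T g ≡ true × f ≢ g
  without⁻ T f {g} T∖fg with f ≟E g
  ... | no  f≢g = trans (sym (∧-identityʳ (T g))) T∖fg , f≢g
  ... | yes _ with trans (sym (∧-zeroʳ (T g))) T∖fg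
  ...   | ()

  Connected : EdgeSet → Set
  Connected T = ∀ v w → Walk T v w

  walk-after-last-use : ∀ {T a v} f → Walk T a v →
    Walk (without T f) a v ⊎
    Walk (without T f) (proj₁ (ends0 f)) v ⊎
    Walk (without T f) (proj₂ (ends0 f)) v
  walk-after-last-use f here = inj₁ here
  walk-after-last-use {T} f (stepₗ g Tg w) with walk-after-last-use f w
  ... | inj₂ later = inj₂ later
  ... | inj₁ w′ with f ≟E g
  ...   | yes refl = inj₂ (inj₂ w′)
  ...   | no  f≢g  = inj₁ (stepₗ g (without⁺ T f Tg f≢g) w′)
  walk-after-last-use {T} f (stepᵣ g Tg w) with walk-after-last-use f w
  ... | inj₂ later = inj₂ later
  ... | inj₁ w′ with f ≟E g
  ...   | yes refl = inj₂ (inj₁ w′)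
  ...   | no  f≢g  = inj₁ (stepᵣ g (without⁺ T f Tg f≢g) w′)

  crosses : (V0 → Bool) → E0 → Bool
  crosses Z g = Z (proj₁ (ends0 g)) xor Z (proj₂ (ends0 g))

  IsProperCut : (V0 → Bool) → Set
  IsProperCut Z = ∃ λ a → ∃ λ b → Z a ≢ Z b

  walk-preserves : ∀ Z {T a v} → (∀ g → T g ≡ true → crosses Z g ≡ false) →
    Walk T a v → Z a ≡ Z v
  walk-preserves Z noCross here = refl
  walk-preserves Z noCross (stepₗ g Tg w) =
    trans (xor≡false⇒≡ (noCross g Tg)) (walk-preserves Z noCross w)
  walk-preserves Z noCross (stepᵣ g Tg w) =
    trans (sym (xor≡false⇒≡ (noCross g Tg))) (walk-preserves Z noCross w)

  walk-crosses : ∀ Z {T a v} → Walk T a v → Z a ≢ Z v →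
    ∃ λ g → T g ≡ true × crosses Z g ≡ true
  walk-crosses Z here Za≢Zv = ⊥-elim (Za≢Zv refl)
  walk-crosses Z (stepₗ g Tg w) Za≢Zv with crosses Z g in X
  ... | true  = g , Tg , X
  ... | false = walk-crosses Z w (λ eq → Za≢Zv (trans (xor≡false⇒≡ X) eq))
  walk-crosses Z (stepᵣ g Tg w) Za≢Zv with crosses Z g in X
  ... | true  = g , Tg , X
  ... | false = walk-crosses Z w (λ eq → Za≢Zv (trans (sym (xor≡false⇒≡ X)) eq))

  connected-crosses : ∀ {Z T} → Connected T → IsProperCut Z →
    ∃ λ g → T g ≡ true × crosses Z g ≡ true
  connected-crosses {Z} conn (a , b , Za≢Zb) = walk-crosses Z (conn a b) Za≢Zb

  componentSide-uniqueCrossing : ∀ Z {T f S} → Connected T → crosses Z f ≡ true →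
    (∀ g → T g ≡ true → crosses Z g ≡ true → g ≡ f) → IsComponentSide T f S →
    ∀ v → S v ≡ not (Z v xor Z (proj₁ (ends0 f)))
  componentSide-uniqueCrossing Z {T} {f} {S} conn Xf unique side v =
    ⇔⇒≡-not-xor (S v) (Z v) (Z f₁) inside⇒sameSide sameSide⇒inside
    where
    f₁ : V0
    f₁ = proj₁ (ends0 f)

    T∖f-noCross : ∀ g → without T f g ≡ true → crosses Z g ≡ false
    T∖f-noCross g T∖fg with without⁻ T f T∖fg | crosses Z g in Xg
    ... | _ , _     | false = refl
    ... | Tg , f≢g  | true  = ⊥-elim (f≢g (sym (unique g Tg Xg)))

    inside⇒sameSide : S v ≡ true → Z v ≡ Z f₁
    inside⇒sameSide Sv = sym (walk-preserves Z T∖f-noCross (proj₁ (side v) Sv))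

    sameSide⇒inside : Z v ≡ Z f₁ → S v ≡ true
    sameSide⇒inside Zv≡Zf₁ with walk-after-last-use f (conn f₁ v)
    ... | inj₁ w        = proj₂ (side v) w
    ... | inj₂ (inj₁ w) = proj₂ (side v) w
    ... | inj₂ (inj₂ w) =
      ⊥-elim (xor≡true⇒≢ Xf (sym (trans (walk-preserves Z T∖f-noCross w) Zv≡Zf₁)))

  ind : Bool → ℕ
  ind b = if b then 1 else 0

  crossings : (V0 → Bool) → EdgeSet → ℕ
  crossings Z A = cutCount0 Z (λ g → ind (A g))

  cutCount0-+ : ∀ Z (M N : E0 → ℕ) →
    cutCount0 Z (λ g → M g + N g) ≡ cutCount0 Z M + cutCount0 Z N
  cutCount0-+ Z M N =
    trans (ΣE0-cong (λ g → mask-+ (crosses Z g) (M g) (N g)))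
          (ΣE0-+ (λ g → mask (crosses Z g) (M g)) (λ g → mask (crosses Z g) (N g)))

  cutCount0-ΣFin : ∀ Z h (M : Fin h → E0 → ℕ) →
    cutCount0 Z (λ g → ΣFin h (λ i → M i g)) ≡ ΣFin h (λ i → cutCount0 Z (M i))
  cutCount0-ΣFin Z h M =
    trans (ΣE0-cong (λ g → mask-ΣFin (crosses Z g) h (λ i → M i g)))
          (ΣE0-comm h (λ i g → mask (crosses Z g) (M i g)))

  cutCount0-not-xor : ∀ Z c {S} → (∀ v → S v ≡ not (Z v xor c)) →
    ∀ M → cutCount0 S M ≡ cutCount0 Z M
  cutCount0-not-xor Z c S≡ M = ΣE0-cong λ g →
    cong (λ b → mask b (M g))
      (trans (cong₂ _xor_ (S≡ (proj₁ (ends0 g))) (S≡ (proj₂ (ends0 g))))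
             (not-xor-xor-not-xor (Z (proj₁ (ends0 g))) (Z (proj₂ (ends0 g))) c))

  crossing≤cutCount0 : ∀ Z M g → crosses Z g ≡ true → M g ≤ cutCount0 Z M
  crossing≤cutCount0 Z M g Xg =
    ≤-trans (≤-reflexive (sym (mask-true (M g) Xg)))
            (term≤ΣE0 (λ g′ → mask (crosses Z g′) (M g′)) g)

  twoCrossings≤cutCount0 : ∀ Z M g g′ → g ≢ g′ →
    crosses Z g ≡ true → crosses Z g′ ≡ true → M g + M g′ ≤ cutCount0 Z M
  twoCrossings≤cutCount0 Z M g g′ g≢g′ Xg Xg′ =
    ≤-trans (≤-reflexive (sym (cong₂ _+_ (mask-true (M g) Xg) (mask-true (M g′) Xg′))))
            (twoTerms≤ΣE0 (λ g″ → mask (crosses Z g″) (M g″)) g g′ g≢g′)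

  member⇒1≤crossings : ∀ Z A {f} → A f ≡ true → crosses Z f ≡ true → 1 ≤ crossings Z A
  member⇒1≤crossings Z A {f} Af Xf =
    subst (λ b → ind b ≤ crossings Z A) Af (crossing≤cutCount0 Z (ind ∘ A) f Xf)

  crossings≤1⇒uniqueCrossing : ∀ Z A {f} → crossings Z A ≤ 1 →
    A f ≡ true → crosses Z f ≡ true → ∀ g → A g ≡ true → crosses Z g ≡ true → g ≡ f
  crossings≤1⇒uniqueCrossing Z A {f} ≤1 Af Xf g Ag Xg with g ≟E f
  ... | yes g≡f = g≡f
  ... | no  g≢f = ⊥-elim (<⇒≱ (s≤s ≤1) (begin
    2                        ≡⟨ cong₂ _+_ (cong ind (sym Ag)) (cong ind (sym Af)) ⟩
    ind (A g) + ind (A f)    ≤⟨ twoCrossings≤cutCount0 Z (ind ∘ A) g f g≢f Xg Xf ⟩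
    crossings Z A            ∎))
    where open ≤-Reasoning

  selectedForF : (E0 → ℕ) → ℕ → (E0 → V0 → Bool) → E0 → Bool
  selectedForF M bound S f = (cutCount0 (S f) M <ᵇ bound) ∧ not (S f u₀ xor S f v₀)

  uniqueCrossing⇒selectedForF : ∀ Z {A f S M bound} → Connected A → crosses Z f ≡ true →
    (∀ g → A g ≡ true → crosses Z g ≡ true → g ≡ f) → IsComponentSide A f (S f) →
    Z u₀ ≡ Z v₀ → cutCount0 Z M < bound → selectedForF M bound S f ≡ true
  uniqueCrossing⇒selectedForF Z {A} {f} {S} {M} {bound} conn Xf unique side Zu₀≡Zv₀ small =
    cong₂ _∧_ (trans (cong (_<ᵇ bound) sameCount) (Equivalence.to T-≡ (<⇒<ᵇ small)))
              (cong not u₀v₀-sameSide)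
    where
    c : Bool
    c = Z (proj₁ (ends0 f))

    S≡ : ∀ v → S f v ≡ not (Z v xor c)
    S≡ = componentSide-uniqueCrossing Z conn Xf unique side

    sameCount : cutCount0 (S f) M ≡ cutCount0 Z M
    sameCount = cutCount0-not-xor Z c S≡ M

    u₀v₀-sameSide : S f u₀ xor S f v₀ ≡ false
    u₀v₀-sameSide = begin
      S f u₀ xor S f v₀                      ≡⟨ cong₂ _xor_ (S≡ u₀) (S≡ v₀) ⟩
      not (Z u₀ xor c) xor not (Z v₀ xor c)  ≡⟨ not-xor-xor-not-xor (Z u₀) (Z v₀) c ⟩
      Z u₀ xor Z v₀                          ≡⟨ cong (_xor Z v₀) Zu₀≡Zv₀ ⟩
      Z v₀ xor Z v₀                          ≡⟨ xor-same (Z v₀) ⟩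
      false                                  ∎
      where open ≡-Reasoning

  tree+selectedForF≥2 : ∀ Z {A S M bound} → Connected A →
    (∀ f → A f ≡ true → IsComponentSide A f (S f)) →
    IsProperCut Z → Z u₀ ≡ Z v₀ → cutCount0 Z M < bound →
    2 ≤ crossings Z A + crossings Z (λ g → A g ∧ selectedForF M bound S g)
  tree+selectedForF≥2 Z {A} {S} {M} {bound} conn sides proper Zu₀≡Zv₀ small
    with connected-crosses conn proper
  ... | f , Af , Xf with crossings Z A ≤? 1
  ...   | no  ≰1 = ≤-trans (≰⇒> ≰1) (m≤m+n _ _)
  ...   | yes ≤1 = +-mono-≤ (member⇒1≤crossings Z A Af Xf)
                            (member⇒1≤crossings Z (λ g → A g ∧ selectedForF M bound S g)
                                                (cong₂ _∧_ Af fSelected) Xf)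
    where
    fSelected : selectedForF M bound S f ≡ true
    fSelected = uniqueCrossing⇒selectedForF Z {A} {f} {S} {M} conn Xf
      (crossings≤1⇒uniqueCrossing Z A ≤1 Af Xf) (sides f Af) Zu₀≡Zv₀ small

  spanningTree⇒connected : ∀ {T} → IsSpanningTree T → Connected T
  spanningTree⇒connected (_ , connected , _) = connected

  mB≤cutCount0-Bmult : ∀ {Z} mB {B₀} → IsSpanningTree B₀ → IsProperCut Z →
    mB ≤ cutCount0 Z (Bmult mB B₀)
  mB≤cutCount0-Bmult {Z} mB {B₀} B₀-tree proper
    with connected-crosses (spanningTree⇒connected B₀-tree) proper
  ... | g , B₀g , Xg = begin
    mB                              ≡⟨ sym (*-identityʳ mB) ⟩
    mB * ind true                   ≡⟨ cong (λ b → mB * ind b) (sym B₀g) ⟩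
    Bmult mB B₀ g                   ≤⟨ crossing≤cutCount0 Z (Bmult mB B₀) g Xg ⟩
    cutCount0 Z (Bmult mB B₀)       ∎
    where open ≤-Reasoning

  -- Fmult k h mB T side f counts, by definition, the i with FEdges k h mB T side i f.
  FEdges : (k h mB : ℕ) → (Fin h → EdgeSet) → (Fin h → E0 → V0 → Bool) → Fin h → EdgeSet
  FEdges k h mB T side i g = T i g ∧ selectedForF (Tstar h T) (k ∸ mB) (side i) g

  cutCount0-total0 : ∀ Z k h mB T B₀ side →
    cutCount0 Z (total0 k h mB T B₀ side) ≡
    ΣFin h (λ i → crossings Z (T i)) + cutCount0 Z (Bmult mB B₀) +
    ΣFin h (λ i → crossings Z (FEdges k h mB T side i))
  cutCount0-total0 Z k h mB T B₀ side = begin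
    cutCount0 Z (λ g → Tstar h T g + Bmult mB B₀ g + Fmult k h mB T side g)
      ≡⟨ cutCount0-+ Z (λ g → Tstar h T g + Bmult mB B₀ g) (Fmult k h mB T side) ⟩
    cutCount0 Z (λ g → Tstar h T g + Bmult mB B₀ g) + cutCount0 Z (Fmult k h mB T side)
      ≡⟨ cong (_+ cutCount0 Z (Fmult k h mB T side)) (cutCount0-+ Z (Tstar h T) (Bmult mB B₀)) ⟩
    cutCount0 Z (Tstar h T) + cutCount0 Z (Bmult mB B₀) + cutCount0 Z (Fmult k h mB T side)
      ≡⟨ cong₂ (λ t f → t + cutCount0 Z (Bmult mB B₀) + f)
               (cutCount0-ΣFin Z h (λ i g → ind (T i g)))
               (cutCount0-ΣFin Z h (λ i g → ind (FEdges k h mB T side i g))) ⟩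
    ΣFin h (λ i → crossings Z (T i)) + cutCount0 Z (Bmult mB B₀) +
    ΣFin h (λ i → crossings Z (FEdges k h mB T side i))
      ∎
    where open ≡-Reasoning

  k≤cutCount0-total0 : ∀ {Z} → IsProperCut Z → Z u₀ ≡ Z v₀ →
    ∀ k h mB → k ≡ 2 * h →
    (T : Fin h → EdgeSet) → (∀ i → IsSpanningTree (T i)) →
    (B₀ : EdgeSet) → IsSpanningTree B₀ →
    (side : Fin h → E0 → V0 → Bool) →
    (∀ i f → T i f ≡ true → IsComponentSide (T i) f (side i f)) →
    k ≤ cutCount0 Z (total0 k h mB T B₀ side)
  k≤cutCount0-total0 {Z} proper Zu₀≡Zv₀ k h mB k≡2h T T-trees B₀ B₀-tree side sides =
    subst (k ≤_) (sym (cutCount0-total0 Z k h mB T B₀ side)) k≤t+Bc+Fc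
    where
    treeCrossings FCrossings : Fin h → ℕ
    treeCrossings i = crossings Z (T i)
    FCrossings i = crossings Z (FEdges k h mB T side i)

    t Bc Fc : ℕ
    t  = ΣFin h treeCrossings
    Bc = cutCount0 Z (Bmult mB B₀)
    Fc = ΣFin h FCrossings

    k≤t+Bc+Fc : k ≤ t + Bc + Fc
    k≤t+Bc+Fc with k ≤? t + mB
    ... | yes k≤t+mB = begin
      k             ≤⟨ k≤t+mB ⟩
      t + mB        ≤⟨ +-monoʳ-≤ t (mB≤cutCount0-Bmult mB B₀-tree proper) ⟩
      t + Bc        ≤⟨ m≤m+n (t + Bc) Fc ⟩
      t + Bc + Fc   ∎
      where open ≤-Reasoning
    ... | no  k≰t+mB = begin
      k                                              ≡⟨ k≡2h ⟩
      2 * h                                          ≤⟨ *-≤-ΣFin h 2 _ twoPerTree ⟩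
      ΣFin h (λ i → treeCrossings i + FCrossings i)  ≡⟨ ΣFin-+ h treeCrossings FCrossings ⟩
      t + Fc                                         ≤⟨ +-monoˡ-≤ Fc (m≤m+n t Bc) ⟩
      t + Bc + Fc                                    ∎
      where
      open ≤-Reasoning
      t<k∸mB : cutCount0 Z (Tstar h T) < k ∸ mB
      t<k∸mB = subst (_< k ∸ mB) (sym (cutCount0-ΣFin Z h (λ i g → ind (T i g))))
                     (m+n≤o⇒m≤o∸n (suc t) (≰⇒> k≰t+mB))
      twoPerTree : ∀ i → 2 ≤ treeCrossings i + FCrossings i
      twoPerTree i = tree+selectedForF≥2 Z {T i} {side i} {Tstar h T} {k ∸ mB}
        (spanningTree⇒connected (T-trees i)) (sides i) proper Zu₀≡Zv₀ t<k∸mB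

  liftCut : (Fin n → Bool) → V0 → Bool
  liftCut S = extend S (S u)

  liftCut-inject₁ : ∀ S w → liftCut S (inject₁ w) ≡ S w
  liftCut-inject₁ S = extend-inject₁ S (S u)

  liftCut-u₀≡v₀ : ∀ S → liftCut S u₀ ≡ liftCut S v₀
  liftCut-u₀≡v₀ S = trans (liftCut-inject₁ S u) (sym (extend-fromℕ n S (S u)))

  liftCut-proper : ∀ {S a b} → S a ≡ true → S b ≡ false → IsProperCut (liftCut S)
  liftCut-proper {S} {a} {b} Sa Sb =
    inject₁ a , inject₁ b ,
    subst₂ _≢_ (sym (trans (liftCut-inject₁ S a) Sa))
               (sym (trans (liftCut-inject₁ S b) Sb)) (λ ())

  cutCountG-project : ∀ S M → cutCountG G S (project M) ≡ cutCount0 (liftCut S) M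
  cutCountG-project S M =
    trans (ΣFin-cong m edgewise) (ΣFin-+ m (λ e → masked (inj₁ e)) (λ e → masked (inj₂ e)))
    where
    masked : E0 → ℕ
    masked g = mask (crosses (liftCut S) g) (M g)

    crossesG : Fin m → Bool
    crossesG e = S (proj₁ (ends e)) xor S (proj₂ (ends e))

    -- the private renaming in ends0 (inj₂ e) of u to v₀, unfolded
    liftCut-rep : ∀ w → liftCut S (if ⌊ w ≟ᶠ u ⌋ then v₀ else inject₁ w) ≡ S w
    liftCut-rep w with w ≟ᶠ u
    ... | yes refl = extend-fromℕ n S (S u)
    ... | no  _    = liftCut-inject₁ S w

    crosses-inj₁ : ∀ e → crosses (liftCut S) (inj₁ e) ≡ crossesG e
    crosses-inj₁ e =
      cong₂ _xor_ (liftCut-inject₁ S (proj₁ (ends e))) (liftCut-inject₁ S (proj₂ (ends e)))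

    crosses-inj₂ : ∀ e → crosses (liftCut S) (inj₂ e) ≡ crossesG e
    crosses-inj₂ e =
      cong₂ _xor_ (liftCut-rep (proj₁ (ends e))) (liftCut-rep (proj₂ (ends e)))

    edgewise : ∀ e → mask (crossesG e) (project M e) ≡ masked (inj₁ e) + masked (inj₂ e)
    edgewise e =
      trans (mask-+ (crossesG e) (M (inj₁ e)) (M (inj₂ e)))
            (cong₂ _+_ (cong (λ b → mask b (M (inj₁ e))) (sym (crosses-inj₁ e)))
                       (cong (λ b → mask b (M (inj₂ e))) (sym (crosses-inj₂ e))))

lemma3p1 : ∀ {n} (G : Graph n) (u : Fin n) (k h : ℕ) → k ≡ 2 * h → 0 < k →
    (mB : ℕ) →
    (T : Fin h → Split.EdgeSet G u) → (∀ i → Split.IsSpanningTree G u (T i)) →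
    (B₀ : Split.EdgeSet G u) → Split.IsSpanningTree G u B₀ →
    (side : Fin h → Split.E0 G u → Split.V0 G u → Bool) →
    (∀ i f → T i f ≡ true → Split.IsComponentSide G u (T i) f (side i f)) →
    KEdgeConnected G k
      (Split.project G u (Split.total0 G u k h mB T B₀ side))
lemma3p1 G u k h k≡2h _ mB T T-trees B₀ B₀-tree side sides S (_ , Sa) (_ , Sb) =
  subst (k ≤_) (sym (cutCountG-project S (Split.total0 G u k h mB T B₀ side)))
    (k≤cutCount0-total0 (liftCut-proper Sa Sb) (liftCut-u₀≡v₀ S)
       k h mB k≡2h T T-trees B₀ B₀-tree side sides)
  where open SplitProperties G u
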